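{- Let $D$ be a diagram with a northeast labeling $\mathcal{L}$. Let $x_1=(r_1,c_1)$ and $x_2=(r_2,c_2)$ be cells of $D$ with $c_1\le c_2$ and $\mathcal{L}(x_1)>\mathcal{L}(x_2)$. Then $r_1>r_2$.
   Context: A diagram is a finite subset of $\mathbb{N}\times\mathbb{N}$; $(r,c)$ is a cell in row $r$, column $c$, rows numbered bottom to top. A labeling of $D$ is a map $\mathcal{L}:D\to\mathbb{N}$; it is strict if labels strictly increase from bottom to top within each column. A northeast labeling is a labeling such that: (1) $\mathcal{L}$ is strict; (2) each label in row $i$ is at least $i$; (3) if $x'$ is in a column strictly to the right of $x$ and $\mathcal{L}(x')<\mathcal{L}(x)$, then there is a cell $x''$ in the column of $x'$ with $\mathcal{L}(x'')=\mathcal{L}(x)$; (4) if $x'$ is in a column strictly to the right of $x$ and $\mathcal{L}(x')=\mathcal{L}(x)$, then $x'$ is weakly below $x$. -}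

module Defs where

open import Data.Nat using (ℕ; _≤_; _<_)
open import Data.Product using (_×_; _,_; proj₁; proj₂; ∃-syntax)
open import Data.List using (List)
open import Data.List.Membership.Propositional using (_∈_)
open import Relation.Binary.PropositionalEquality using (_≡_)

-- A cell is (r , c): row r (numbered bottom to top), column c.
Cell : Set
Cell = ℕ × ℕ

row : Cell → ℕ
row = proj₁

col : Cell → ℕ
col = proj₂

-- A diagram is a finite subset of ℕ × ℕ, represented by a list of its cells
-- (membership is what matters).
Diagram : Set
Diagram = List Cell

-- A labeling of D; only its values on cells of D are relevant.
Labeling : Set
Labeling = Cell → ℕ

Strict : Diagram → Labeling → Set
Strict D L = ∀ x y → x ∈ D → y ∈ D → col x ≡ col y → row x < row y → L x < L y

record Northeast (D : Diagram) (L : Labeling) : Set where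
  field
    strict : Strict D L
    rowBound : ∀ x → x ∈ D → row x ≤ L x
    cond3 : ∀ x x' → x ∈ D → x' ∈ D → col x < col x' → L x' < L x →
            ∃[ x'' ] (x'' ∈ D × col x'' ≡ col x' × L x'' ≡ L x)
    cond4 : ∀ x x' → x ∈ D → x' ∈ D → col x < col x' → L x' ≡ L x →
            row x' ≤ row x

-- If c₁ < c₂, a cell in the column of x₂ carrying the label of x₁ (condition 3) lies above x₂ by
-- strictness and weakly below x₁ by condition 4.

module Submission where

open import Defs
open import Data.Nat using (ℕ; _≤_; _<_; _>_)
open import Data.Nat.Properties using (<-cmp; <-asym; <-irrefl; <-≤-trans; m≤n⇒m<n∨m≡n)
open import Data.List.Membership.Propositional using (_∈_)
open import Data.Product using (_,_)
open import Data.Sum using (inj₁; inj₂)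
open import Relation.Binary.PropositionalEquality using (_≡_; refl; sym; subst)
open import Relation.Binary using (tri<; tri≈; tri>)
open import Data.Empty using (⊥-elim)

strict-reflects-< : ∀ {D L} → Strict D L →
  ∀ y z → y ∈ D → z ∈ D → col y ≡ col z → L y > L z → row y > row z
strict-reflects-< strict (ry , cy) (rz , cz) yD zD refl lz<ly with <-cmp ry rz
... | tri< ry<rz _ _ = ⊥-elim (<-asym lz<ly (strict _ _ yD zD refl ry<rz))
... | tri≈ _ refl _ = ⊥-elim (<-irrefl refl lz<ly)
... | tri> _ _ rz<ry = rz<ry

lemma2p9 : (D : Diagram) (L : Labeling) → Northeast D L →
    (x₁ x₂ : Cell) → x₁ ∈ D → x₂ ∈ D →
    col x₁ ≤ col x₂ → L x₁ > L x₂ → row x₁ > row x₂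
lemma2p9 D L ne x₁ x₂ x₁∈D x₂∈D c₁≤c₂ l₂<l₁ with m≤n⇒m<n∨m≡n c₁≤c₂
... | inj₂ c₁≡c₂ = strict-reflects-< strict x₁ x₂ x₁∈D x₂∈D c₁≡c₂ l₂<l₁
  where open Northeast ne
... | inj₁ c₁<c₂ with Northeast.cond3 ne x₁ x₂ x₁∈D x₂∈D c₁<c₂ l₂<l₁
... | x , x∈D , cx≡c₂ , lx≡l₁ = <-≤-trans x₂-below-x x-weakly-below-x₁
  where
  open Northeast ne

  x₂-below-x : row x₂ < row x
  x₂-below-x = strict-reflects-< strict x x₂ x∈D x₂∈D cx≡c₂ (subst (L x₂ <_) (sym lx≡l₁) l₂<l₁)

  x-weakly-below-x₁ : row x ≤ row x₁
  x-weakly-below-x₁ = cond4 x₁ x x₁∈D x∈D (subst (col x₁ <_) (sym cx≡c₂) c₁<c₂) lx≡l₁
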